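{- Let $T$ be a finite rooted tree and suppose each node $u$ of $T$ is assigned integers $a(u), b(u)$ and the interval $I(u) = [a(u), b(u)]$. For a node $u$ let $T_u$ be the set of descendants of $u$ (including $u$), and let $\overline{a}(u) = \max_{v \in T_u} a(v)$ and $\overline{b}(u) = \max_{v \in T_u} b(v)$. Suppose the assignment is left-including, i.e. for all $u,v \in T$, $u$ is an ancestor of $v$ if and only if $a(v) \in I(u)$. Then: (1) for each $u \in T$, $b(u) \ge \overline{a}(u)$; (2) for each $u \in T$ and each $v \in T_u \setminus \{u\}$, $a(v) > a(u)$; (3) for each $u \in T$, $[a(u), \overline{b}(u)] = \bigcup_{v \in T_u} [a(v), b(v)]$; (4) for any two distinct nodes $u,v \in T$ such that neither is an ancestor of the other, the intervals $[a(u), \overline{b}(u)]$ and $[a(v), \overline{b}(v)]$ are disjoint.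
   Context: In a rooted tree, $u$ is an ancestor of $v$ (equivalently $v$ is a descendant of $u$) if $u$ lies on the unique path from the root to $v$; every node is an ancestor and a descendant of itself. $[x,y]$ denotes the closed interval $\{z : x \le z \le y\}$. -}

module Defs where

open import Data.Nat as ℕ using (ℕ; zero; suc; _+_; z≤n; s≤s)
open import Data.Nat.Properties as ℕP using (≤-refl; m≤n⇒m≤1+n; ≤-pred)
open import Data.Fin using (Fin; _≟_)
open import Data.List using (List; foldr)
open import Data.Fin.Base using ()
open import Data.List.Base using ()
open import Data.Product using (Σ; ∃; _×_; _,_; proj₁; proj₂)
open import Data.Integer using (ℤ; _⊔_)
open import Relation.Nullary using (Dec; yes; no; ¬_)
open import Relation.Nullary.Decidable using (does)
open import Relation.Binary.PropositionalEquality using (_≡_; refl; sym; trans; cong)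
open import Data.Empty using (⊥-elim)
open import Data.Sum using (inj₁; inj₂)
open import Data.Bool using (if_then_else_)
import Data.List as L

iter : ∀ {n} → (Fin n → Fin n) → ℕ → Fin n → Fin n
iter f zero v = v
iter f (suc k) v = f (iter f k v)

-- A finite rooted tree on the node set Fin n, given by its parent map:
-- the root is its own parent (convention), and every node reaches the root
-- by iterating the parent map.  (Edges: v -- parent v for v ≠ root.)
record RootedTree (n : ℕ) : Set where
  field
    root        : Fin n
    parent      : Fin n → Fin n
    parent-root : parent root ≡ root
    reaches     : ∀ v → ∃ λ k → iter parent k v ≡ root

Ancestor : ∀ {n} → RootedTree n → Fin n → Fin n → Set
Ancestor T u v = ∃ λ k → iter (RootedTree.parent T) k v ≡ u

private
  boundedSearch : (P : ℕ → Set) → (∀ k → Dec (P k)) → (K : ℕ) →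
                  Dec (∃ λ k → k ℕ.≤ K × P k)
  boundedSearch P d zero with d zero
  ... | yes p = yes (zero , z≤n , p)
  ... | no ¬p = no λ { (zero , _ , p) → ¬p p ; (suc k , () , _) }
  boundedSearch P d (suc K) with d (suc K)
  ... | yes p = yes (suc K , ≤-refl , p)
  ... | no ¬p with boundedSearch P d K
  ...   | yes (k , k≤K , p) = yes (k , m≤n⇒m≤1+n k≤K , p)
  ...   | no ¬q = no λ { (k , k≤ , p) → helper k k≤ p }
    where
    helper : ∀ k → k ℕ.≤ suc K → P k → _
    helper k k≤ p with k ℕ.≟ suc K
    ... | yes refl = ¬p p
    ... | no k≢ = ¬q (k , ≤-pred (ℕP.≤∧≢⇒< k≤ k≢) , p)

  iter-root : ∀ {n} (T : RootedTree n) k →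
              iter (RootedTree.parent T) k (RootedTree.root T) ≡ RootedTree.root T
  iter-root T zero = refl
  iter-root T (suc k) = trans (cong (RootedTree.parent T) (iter-root T k))
                              (RootedTree.parent-root T)

  iter-+ : ∀ {n} (f : Fin n → Fin n) j K v → iter f (j + K) v ≡ iter f j (iter f K v)
  iter-+ f zero K v = refl
  iter-+ f (suc j) K v = cong f (iter-+ f j K v)

ancestor? : ∀ {n} (T : RootedTree n) (u v : Fin n) → Dec (Ancestor T u v)
ancestor? {n} T u v with RootedTree.reaches T v
... | K , eK with boundedSearch (λ k → iter p k v ≡ u) (λ k → iter p k v ≟ u) K
  where p = RootedTree.parent T
... | yes (k , _ , e) = yes (k , e)
... | no ¬q = no λ { (k , e) → go k e }
  where
  p = RootedTree.parent T
  go : ∀ k → iter p k v ≡ u → _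
  go k e with ℕP.≤-total k K
  ... | inj₁ k≤K = ¬q (k , k≤K , e)
  ... | inj₂ K≤k with ℕP.m≤n⇒∃[o]m+o≡n K≤k
  ...   | j , refl = ¬q (K , ≤-refl ,
            trans eK (trans (sym (iter-root T j))
              (trans (cong (iter p j) (sym eK)) (trans (trans (sym (iter-+ p j K v)) (cong (λ m → iter p m v) (ℕP.+-comm j K))) e))))


maxOverSubtree : ∀ {n} → RootedTree n → (Fin n → ℤ) → Fin n → ℤ
maxOverSubtree {n} T f u =
  foldr (λ v m → if does (ancestor? T u v) then f v ⊔ m else m) (f u) (L.allFin n)

module Submission where

-- The ancestor relation of a rooted tree (given by a parent
-- map) is a partial order whose principal down-sets are chains: two
-- ancestors of a common node are comparable.  The subtree maximum
-- maxOverSubtree T f u bounds f on T_u and is attained at some node of T_u.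
-- For a left-including assignment a, b these facts give, in turn:
--   (1) ā(u) = a(w) for some w ∈ T_u, and a(w) ≤ b(u) because a(w) ∈ I(u);
--   (2) a(u) ≤ a(v) by left-inclusion, and equality would put a(u) in I(v),
--       making v an ancestor of u, hence v = u by antisymmetry;
--   (3) ⊇ is immediate from the bounds; for ⊆ take w ∈ T_u with b̄(u) = b(w)
--       and walk down the path from u to w, stopping at the last node whose
--       left endpoint is ≤ z;
--   (4) two intervals I(x), I(y) with a common point force x, y to be
--       comparable, so by (3) a common point of the two hulls would make
--       u and v comparable.

open import Defs
open import Data.Nat using (zero; suc; _+_; _*_)
import Data.Nat.Properties as ℕP
open import Data.Fin using (Fin)
open import Data.Integer using (ℤ; _≤_; _<_; _⊔_)
import Data.Integer.Properties as ℤP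
open import Data.Product using (∃; _×_; _,_; proj₁; proj₂)
open import Data.Sum using (_⊎_; inj₁; inj₂)
open import Data.List using ([]; _∷_; foldr; allFin)
open import Data.List.Relation.Unary.Any using (here; there)
open import Data.List.Membership.Propositional using (_∈_)
open import Data.List.Membership.Propositional.Properties using (∈-allFin)
open import Data.Bool using (if_then_else_)
open import Data.Empty using (⊥-elim)
open import Function.Bundles using (_⇔_; mk⇔; Equivalence)
open import Relation.Nullary using (¬_; yes; no)
open import Relation.Nullary.Decidable using (does)
open import Relation.Binary.PropositionalEquality
  using (_≡_; _≢_; refl; sym; trans; cong; subst; module ≡-Reasoning)

iter-+ : ∀ {n} (f : Fin n → Fin n) j K v → iter f (j + K) v ≡ iter f j (iter f K v)
iter-+ f zero    K v = refl
iter-+ f (suc j) K v = cong f (iter-+ f j K v)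

iter-periodic : ∀ {n} (f : Fin n → Fin n) p v → iter f p v ≡ v →
                ∀ m → iter f (m * p) v ≡ v
iter-periodic f p v per zero    = refl
iter-periodic f p v per (suc m) = begin
  iter f (p + m * p) v        ≡⟨ iter-+ f p (m * p) v ⟩
  iter f p (iter f (m * p) v) ≡⟨ cong (iter f p) (iter-periodic f p v per m) ⟩
  iter f p v                  ≡⟨ per ⟩
  v                           ∎
  where open ≡-Reasoning

module TreeOrder {n} (T : RootedTree n) where
  open RootedTree T

  iter-root : ∀ k → iter parent k root ≡ root
  iter-root zero    = refl
  iter-root (suc k) = trans (cong parent (iter-root k)) parent-root

  -- The only node lying on a non-trivial cycle of the parent map is the
  -- root: iterating the cycle long enough passes through the root.
  cycle⇒root : ∀ q v → iter parent (suc q) v ≡ v → v ≡ root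
  cycle⇒root q v cyc with reaches v
  ... | K , reachK with ℕP.m≤n⇒∃[o]m+o≡n (ℕP.m≤m*n K (suc q))
  ... | o , K+o≡ = begin
    v                              ≡⟨ sym (iter-periodic parent (suc q) v cyc K) ⟩
    iter parent (K * suc q) v      ≡⟨ cong (λ m → iter parent m v) (trans (sym K+o≡) (ℕP.+-comm K o)) ⟩
    iter parent (o + K) v          ≡⟨ iter-+ parent o K v ⟩
    iter parent o (iter parent K v) ≡⟨ cong (iter parent o) reachK ⟩
    iter parent o root             ≡⟨ iter-root o ⟩
    root                           ∎
    where open ≡-Reasoning

  ancestor-refl : ∀ {u} → Ancestor T u u
  ancestor-refl = 0 , refl

  ancestor-trans : ∀ {u v w} → Ancestor T u v → Ancestor T v w → Ancestor T u w
  ancestor-trans {w = w} (k , vk≡u) (j , wj≡v) =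
    k + j , trans (iter-+ parent k j w) (trans (cong (iter parent k) wj≡v) vk≡u)

  ancestor-parent : ∀ {u v} → Ancestor T u v → Ancestor T (parent u) v
  ancestor-parent (k , e) = suc k , cong parent e

  -- The ancestor relation is antisymmetric: a two-way path is a cycle,
  -- which only the root admits.
  ancestor-antisym : ∀ {u v} → Ancestor T u v → Ancestor T v u → v ≡ u
  ancestor-antisym (zero , e) _ = e
  ancestor-antisym {u} {v} (suc k , uk≡v) (j , vj≡u) = begin
    v                  ≡⟨ sym vj≡u ⟩
    iter parent j u    ≡⟨ cong (iter parent j) u≡root ⟩
    iter parent j root ≡⟨ iter-root j ⟩
    root               ≡⟨ sym u≡root ⟩
    u                  ∎
    where
    open ≡-Reasoning
    u≡root : u ≡ root
    u≡root = cycle⇒root (k + j) u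
      (trans (iter-+ parent (suc k) j u) (trans (cong (iter parent (suc k)) vj≡u) uk≡v))

  ancestor-further : ∀ {u v w} k o → iter parent k w ≡ u → iter parent (k + o) w ≡ v →
                     Ancestor T v u
  ancestor-further {w = w} k o wk≡u wko≡v = o , (begin
    iter parent o _                ≡⟨ cong (iter parent o) (sym wk≡u) ⟩
    iter parent o (iter parent k w) ≡⟨ sym (iter-+ parent o k w) ⟩
    iter parent (o + k) w          ≡⟨ cong (λ m → iter parent m w) (ℕP.+-comm o k) ⟩
    iter parent (k + o) w          ≡⟨ wko≡v ⟩
    _                              ∎)
    where open ≡-Reasoning

  Comparable : Fin n → Fin n → Set
  Comparable u v = Ancestor T u v ⊎ Ancestor T v u

  ancestors-comparable : ∀ {u v w} → Ancestor T u w → Ancestor T v w → Comparable u v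
  ancestors-comparable (k , wk≡u) (j , wj≡v) with ℕP.≤-total k j
  ... | inj₁ k≤j with ℕP.m≤n⇒∃[o]m+o≡n k≤j
  ...   | o , refl = inj₂ (ancestor-further k o wk≡u wj≡v)
  ancestors-comparable (k , wk≡u) (j , wj≡v) | inj₂ j≤k with ℕP.m≤n⇒∃[o]m+o≡n j≤k
  ...   | o , refl = inj₁ (ancestor-further j o wj≡v wk≡u)

  comparable-ancestors : ∀ {u v x y} → Ancestor T u x → Ancestor T v y →
                         Comparable x y → Comparable u v
  comparable-ancestors ux vy (inj₁ xy) = ancestors-comparable (ancestor-trans ux xy) vy
  comparable-ancestors ux vy (inj₂ yx) = ancestors-comparable ux (ancestor-trans vy yx)

module SubtreeMax {n} (T : RootedTree n) (f : Fin n → ℤ) (u : Fin n) where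
  open TreeOrder T using (ancestor-refl)

  step : Fin n → ℤ → ℤ
  step v m = if does (ancestor? T u v) then f v ⊔ m else m

  fold-upper : ∀ xs v → v ∈ xs → Ancestor T u v → f v ≤ foldr step (f u) xs
  fold-upper (x ∷ xs) v (here refl) uv with ancestor? T u x
  ... | yes _  = ℤP.i≤i⊔j (f x) _
  ... | no ¬uv = ⊥-elim (¬uv uv)
  fold-upper (x ∷ xs) v (there v∈xs) uv with ancestor? T u x
  ... | yes _ = ℤP.≤-trans (fold-upper xs v v∈xs uv) (ℤP.i≤j⊔i (f x) _)
  ... | no _  = fold-upper xs v v∈xs uv

  fold-attained : ∀ xs → ∃ λ w → Ancestor T u w × foldr step (f u) xs ≡ f w
  fold-attained [] = u , ancestor-refl , refl
  fold-attained (x ∷ xs) with ancestor? T u x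
  ... | no _ = fold-attained xs
  ... | yes ux with ℤP.⊔-sel (f x) (foldr step (f u) xs)
  ...   | inj₁ e = x , ux , e
  ...   | inj₂ e with fold-attained xs
  ...     | w , uw , e′ = w , uw , trans e e′

  max-upper : ∀ v → Ancestor T u v → f v ≤ maxOverSubtree T f u
  max-upper v = fold-upper (allFin n) v (∈-allFin v)

  max-attained : ∃ λ w → Ancestor T u w × maxOverSubtree T f u ≡ f w
  max-attained = fold-attained (allFin n)

module LeftIncluding {n} (T : RootedTree n) (a b : Fin n → ℤ)
                     (left-incl : ∀ u v → Ancestor T u v ⇔ (a u ≤ a v × a v ≤ b u)) where
  open RootedTree T
  open TreeOrder T

  _∈I_ : ℤ → Fin n → Set
  z ∈I v = a v ≤ z × z ≤ b v

  ancestor⇒∈I : ∀ {u v} → Ancestor T u v → a v ∈I u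
  ancestor⇒∈I {u} {v} = Equivalence.to (left-incl u v)

  ∈I⇒ancestor : ∀ {u v} → a v ∈I u → Ancestor T u v
  ∈I⇒ancestor {u} {v} = Equivalence.from (left-incl u v)

  a∈I : ∀ v → a v ∈I v
  a∈I v = ancestor⇒∈I ancestor-refl

  max-a≤b : ∀ u → maxOverSubtree T a u ≤ b u
  max-a≤b u with SubtreeMax.max-attained T a u
  ... | w , uw , max≡ = subst (_≤ b u) (sym max≡) (proj₂ (ancestor⇒∈I uw))

  a-strict : ∀ u v → Ancestor T u v → v ≢ u → a u < a v
  a-strict u v uv v≢u = ℤP.≤∧≢⇒< (proj₁ (ancestor⇒∈I uv)) λ au≡av →
    v≢u (ancestor-antisym uv (∈I⇒ancestor (subst (λ z → z ∈I v) (sym au≡av) (a∈I v))))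

  -- A point of I(w) lying right of a(x), for an ancestor x of w, lies in
  -- I(v) for some v on the path from x to w: take the lowest node of the
  -- path whose left endpoint is still ≤ z.
  descend : ∀ z k w → a (iter parent k w) ≤ z → z ≤ b w →
            ∃ λ v → Ancestor T (iter parent k w) v × z ∈I v
  descend z zero    w ax≤z z≤bw = w , ancestor-refl , ax≤z , z≤bw
  descend z (suc k) w ax≤z z≤bw with ℤP.≤-total (a (iter parent k w)) z
  ... | inj₁ ay≤z with descend z k w ay≤z z≤bw
  ...   | v , yv , z∈Iv = v , ancestor-parent yv , z∈Iv
  descend z (suc k) w ax≤z z≤bw | inj₂ z≤ay =
    iter parent (suc k) w , ancestor-refl , ax≤z ,
      ℤP.≤-trans z≤ay (proj₂ (ancestor⇒∈I (ancestor-parent ancestor-refl)))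

  hull⇔union : ∀ u z → (a u ≤ z × z ≤ maxOverSubtree T b u)
                       ⇔ (∃ λ v → Ancestor T u v × z ∈I v)
  hull⇔union u z = mk⇔ to from
    where
    to : a u ≤ z × z ≤ maxOverSubtree T b u → ∃ λ v → Ancestor T u v × z ∈I v
    to (au≤z , z≤max) with SubtreeMax.max-attained T b u
    ... | w , (k , refl) , max≡ = descend z k w au≤z (subst (z ≤_) max≡ z≤max)
    from : (∃ λ v → Ancestor T u v × z ∈I v) → a u ≤ z × z ≤ maxOverSubtree T b u
    from (v , uv , av≤z , z≤bv) =
      ℤP.≤-trans (proj₁ (ancestor⇒∈I uv)) av≤z ,
      ℤP.≤-trans z≤bv (SubtreeMax.max-upper T b u v uv)

  -- Intervals with a common point belong to comparable nodes: the node
  -- with the smaller left endpoint contains the other's left endpoint.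
  overlap⇒comparable : ∀ {x y z} → z ∈I x → z ∈I y → Comparable x y
  overlap⇒comparable {x} {y} (ax≤z , z≤bx) (ay≤z , z≤by) with ℤP.≤-total (a x) (a y)
  ... | inj₁ ax≤ay = inj₁ (∈I⇒ancestor (ax≤ay , ℤP.≤-trans ay≤z z≤bx))
  ... | inj₂ ay≤ax = inj₂ (∈I⇒ancestor (ay≤ax , ℤP.≤-trans ax≤z z≤by))

  hulls-disjoint : ∀ u v → ¬ Ancestor T u v → ¬ Ancestor T v u →
                   ∀ z → ¬ ((a u ≤ z × z ≤ maxOverSubtree T b u)
                            × (a v ≤ z × z ≤ maxOverSubtree T b v))
  hulls-disjoint u v ¬uv ¬vu z (z∈hull-u , z∈hull-v)
    with Equivalence.to (hull⇔union u z) z∈hull-u | Equivalence.to (hull⇔union v z) z∈hull-v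
  ... | x , ux , z∈Ix | y , vy , z∈Iy
    with comparable-ancestors ux vy (overlap⇒comparable z∈Ix z∈Iy)
  ...   | inj₁ uv = ¬uv uv
  ...   | inj₂ vu = ¬vu vu

lemma1 : ∀ {n} (T : RootedTree n) (a b : Fin n → ℤ) →
         -- left-including: u ancestor of v  iff  a(v) ∈ [a(u), b(u)]
         (∀ u v → Ancestor T u v ⇔ (a u ≤ a v × a v ≤ b u)) →
         -- (1) b(u) ≥ ā(u)
         (∀ u → maxOverSubtree T a u ≤ b u)
         -- (2) a(v) > a(u) for v ∈ T_u \ {u}
         × (∀ u v → Ancestor T u v → v ≢ u → a u < a v)
         -- (3) [a(u), b̄(u)] = ⋃_{v ∈ T_u} [a(v), b(v)]
         × (∀ u (z : ℤ) → (a u ≤ z × z ≤ maxOverSubtree T b u)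
                           ⇔ (∃ λ v → Ancestor T u v × a v ≤ z × z ≤ b v))
         -- (4) incomparable distinct nodes have disjoint [a, b̄] intervals
         × (∀ u v → u ≢ v → ¬ Ancestor T u v → ¬ Ancestor T v u →
              ∀ (z : ℤ) → ¬ ((a u ≤ z × z ≤ maxOverSubtree T b u)
                              × (a v ≤ z × z ≤ maxOverSubtree T b v)))
lemma1 T a b left-incl =
  max-a≤b , a-strict , hull⇔union , λ u v _ → hulls-disjoint u v
  where open LeftIncluding T a b left-incl
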